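{- Let $u$ be a $p\times b$ partial permutation and $v$ an $a\times q$ partial permutation. There is a unique $w\in S_\infty$ whose Rothe diagram is \[ D(w)=([a]\times[b])\cup\{(i,b+j):(i,j)\in D(v)\}\cup\{(a+i,j):(i,j)\in D(u)\}, \] i.e. $D(w)$ consists of the full $a\times b$ rectangle in the upper left, a copy of $D(v)$ to its right, and a copy of $D(u)$ below it.
   Context: A partial permutation is an $m\times n$ $0$–$1$ matrix with at most one $1$ in each row and column; its diagram is $D(u)=\{(i,j)\in[m]\times[n]:$ $u$ has no $1$ in row $i$ in a column $\le j$ and no $1$ in column $j$ in a row $\le i\}$. $S_\infty$ is the group of bijections of the positive integers fixing all but finitely many; for $w\in S_\infty$, $D(w)=\{(i,j):w(i)>j,\ w^{ -1}(j)>i\}$. -}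

module Defs where

-- Conventions: all indices are 0-based (row/column k here = row/column k+1
-- in the paper); the shift is applied uniformly, so diagrams correspond exactly.

open import Data.Nat using (ℕ; _+_; _<_; _≤_; _>_)
open import Data.Fin using (Fin; toℕ)
open import Data.Bool using (Bool; true; false)
open import Data.Product using (Σ; ∃; _×_; Σ-syntax; ∃-syntax)
open import Data.Sum using (_⊎_)
open import Relation.Binary.PropositionalEquality using (_≡_)

Matrix01 : ℕ → ℕ → Set
Matrix01 m n = Fin m → Fin n → Bool

IsPartialPerm : ∀ {m n} → Matrix01 m n → Set
IsPartialPerm {m} {n} M =
  (∀ (i : Fin m) (j j′ : Fin n) → M i j ≡ true → M i j′ ≡ true → j ≡ j′) ×
  (∀ (i i′ : Fin m) (j : Fin n) → M i j ≡ true → M i′ j ≡ true → i ≡ i′)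

InDiagPP : ∀ {m n} → Matrix01 m n → Fin m → Fin n → Set
InDiagPP {m} {n} M i j =
  (∀ (j′ : Fin n) → toℕ j′ ≤ toℕ j → M i j′ ≡ false) ×
  (∀ (i′ : Fin m) → toℕ i′ ≤ toℕ i → M i′ j ≡ false)

record Perm∞ : Set where
  field
    fun    : ℕ → ℕ
    inv    : ℕ → ℕ
    inv∘fun : ∀ n → inv (fun n) ≡ n
    fun∘inv : ∀ n → fun (inv n) ≡ n
    finSupp : ∃[ N ] (∀ n → N ≤ n → fun n ≡ n)
open Perm∞ public

InRothe : Perm∞ → ℕ → ℕ → Set
InRothe w i j = (fun w i > j) × (inv w j > i)

InTarget : ∀ {p b a q} → Matrix01 p b → Matrix01 a q → ℕ → ℕ → Set
InTarget {p} {b} {a} {q} u v i j =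
  ((i < a) × (j < b)) ⊎
  ((Σ[ i′ ∈ Fin a ] Σ[ j′ ∈ Fin q ]
      (i ≡ toℕ i′) × (j ≡ b + toℕ j′) × InDiagPP v i′ j′) ⊎
   (Σ[ i′ ∈ Fin p ] Σ[ j′ ∈ Fin b ]
      (i ≡ a + toℕ i′) × (j ≡ toℕ j′) × InDiagPP u i′ j′))

HasDiagram : Perm∞ → (ℕ → ℕ → Set) → Set
HasDiagram w S = ∀ i j → (InRothe w i j → S i j) × (S i j → InRothe w i j)

-- Write w = prepend c w′ with c = w 0 (so w 1, w 2, … is w′ with the value c punched in).  Then
-- D(w) consists of row 0 = [0, c) on top of D(w′) with a new column c inserted, which stays empty
-- below row 0.  The diagram of a partial permutation M peels off in exactly this way: if row 0
-- of M has its 1 in column c, then row 0 of D(M) is [0, c), column c of D(M) is empty below it,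
-- and what remains is D(M′) for M′ = M without row 0 and column c (if row 0 is empty, take c one
-- past the last column).  The target set peels in the same way row by row, first through the
-- rows of v (where the rectangle fills [0, b) in front of the shifted row of D(v)) and then
-- through those of u, so induction builds w.  Uniqueness holds for any set of cells: two
-- permutations with the same diagram that first differ at i contradict each other at (i, w i).

module Submission where

open import Defs
open import Data.Nat using (ℕ)
open import Data.Product using (Σ; _×_; Σ-syntax)
open import Relation.Binary.PropositionalEquality using (_≡_)

open import Data.Nat using (zero; suc; _+_; _<_; _≤_; _>_; _≮_; z≤n; s≤s; _⊔_; pred; _≟_)
open import Data.Nat.Properties
  using (suc-injective; ≤-pred; ≤-refl; ≤-trans; <-≤-trans; ≤-<-trans; <-irrefl; <-asym; <-cmp; n≢0⇒n>0;
         m≤m⊔n; m≤n⊔m; n≤1+n; n≮0; <⇒≢; >⇒≢;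
         +-monoʳ-<; +-cancelˡ-<; m≤n⇒∃[o]m+o≡n; ≰⇒>; m≤m+n; ≮⇒≥; _<?_)
open import Data.Nat.Induction using (<-rec)
open import Data.Fin using (Fin; toℕ; fromℕ<; punchIn; punchOut) renaming (zero to fzero; suc to fsuc)
import Data.Fin as Fin
import Data.Fin.Properties as Fin
open import Data.Fin.Properties
  using (toℕ<n; toℕ-fromℕ<; punchIn-injective; punchIn-mono-≤; punchIn-cancel-≤; punchIn-punchOut)
open import Data.Product using (_,_; proj₁; proj₂)
open import Data.Sum using (inj₁; inj₂)
open import Data.Bool using (true; false)
import Data.Bool as Bool
open import Data.Bool.Properties using (¬-not)
open import Data.Empty using (⊥-elim)
open import Function using (_∘_; _⇔_; mk⇔; Equivalence)
open import Relation.Nullary using (¬_; yes; no; contradiction)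
open import Relation.Binary.PropositionalEquality using (refl; sym; trans; cong; subst; _≢_; module ≡-Reasoning)
open import Relation.Binary.Definitions using (tri<; tri≈; tri>)

punchInℕ : ℕ → ℕ → ℕ
punchInℕ zero    j       = suc j
punchInℕ (suc c) zero    = zero
punchInℕ (suc c) (suc j) = suc (punchInℕ c j)

punchOutℕ : ℕ → ℕ → ℕ
punchOutℕ zero    j       = pred j
punchOutℕ (suc c) zero    = zero
punchOutℕ (suc c) (suc j) = suc (punchOutℕ c j)

punchInℕᵢ≢i : ∀ c j → punchInℕ c j ≢ c
punchInℕᵢ≢i (suc c) (suc j) = punchInℕᵢ≢i c j ∘ suc-injective

punchOutℕ-punchInℕ : ∀ c j → punchOutℕ c (punchInℕ c j) ≡ j
punchOutℕ-punchInℕ zero    j       = refl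
punchOutℕ-punchInℕ (suc c) zero    = refl
punchOutℕ-punchInℕ (suc c) (suc j) = cong suc (punchOutℕ-punchInℕ c j)

punchInℕ-punchOutℕ : ∀ {c j} → j ≢ c → punchInℕ c (punchOutℕ c j) ≡ j
punchInℕ-punchOutℕ {zero}  {zero}  0≢0 = contradiction refl 0≢0
punchInℕ-punchOutℕ {zero}  {suc j} _   = refl
punchInℕ-punchOutℕ {suc c} {zero}  _   = refl
punchInℕ-punchOutℕ {suc c} {suc j} j≢c = cong suc (punchInℕ-punchOutℕ (j≢c ∘ cong suc))

punchInℕ-injective : ∀ c {j k} → punchInℕ c j ≡ punchInℕ c k → j ≡ k
punchInℕ-injective c {j} {k} eq = begin
  j                          ≡⟨ sym (punchOutℕ-punchInℕ c j) ⟩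
  punchOutℕ c (punchInℕ c j) ≡⟨ cong (punchOutℕ c) eq ⟩
  punchOutℕ c (punchInℕ c k) ≡⟨ punchOutℕ-punchInℕ c k ⟩
  k                          ∎
  where open ≡-Reasoning

punchInℕ-mono-< : ∀ c {j k} → j < k → punchInℕ c j < punchInℕ c k
punchInℕ-mono-< zero    j<k             = s≤s j<k
punchInℕ-mono-< (suc c) {zero}  {suc k} _         = s≤s z≤n
punchInℕ-mono-< (suc c) {suc j} {suc k} (s≤s j<k) = s≤s (punchInℕ-mono-< c j<k)

punchInℕ-cancel-< : ∀ c {j k} → punchInℕ c j < punchInℕ c k → j < k
punchInℕ-cancel-< zero    (s≤s j<k) = j<k
punchInℕ-cancel-< (suc c) {zero}  {zero}  ()
punchInℕ-cancel-< (suc c) {zero}  {suc k} _         = s≤s z≤n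
punchInℕ-cancel-< (suc c) {suc j} {suc k} (s≤s j<k) = s≤s (punchInℕ-cancel-< c j<k)

punchInℕ-< : ∀ {c j} → j < c → punchInℕ c j ≡ j
punchInℕ-< {suc c} {zero}  _         = refl
punchInℕ-< {suc c} {suc j} (s≤s j<c) = cong suc (punchInℕ-< j<c)

punchInℕ-≥ : ∀ {c j} → c ≤ j → punchInℕ c j ≡ suc j
punchInℕ-≥ {zero}  _         = refl
punchInℕ-≥ {suc c} (s≤s c≤j) = cong suc (punchInℕ-≥ c≤j)

j≤punchInℕ : ∀ c j → j ≤ punchInℕ c j
j≤punchInℕ zero    j       = n≤1+n j
j≤punchInℕ (suc c) zero    = z≤n
j≤punchInℕ (suc c) (suc j) = s≤s (j≤punchInℕ c j)

punchInℕ<c⇒≡ : ∀ {c j} → punchInℕ c j < c → punchInℕ c j ≡ j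
punchInℕ<c⇒≡ {c} {j} p<c = punchInℕ-< (≤-<-trans (j≤punchInℕ c j) p<c)

punchInℕ-+ : ∀ s c j → punchInℕ (s + c) (s + j) ≡ s + punchInℕ c j
punchInℕ-+ zero    c j = refl
punchInℕ-+ (suc s) c j = cong suc (punchInℕ-+ s c j)

toℕ-punchIn : ∀ {n} (c : Fin (suc n)) (j : Fin n) → toℕ (punchIn c j) ≡ punchInℕ (toℕ c) (toℕ j)
toℕ-punchIn fzero    j        = refl
toℕ-punchIn (fsuc c) fzero    = refl
toℕ-punchIn (fsuc c) (fsuc j) = cong suc (toℕ-punchIn c j)

fun≡⇒inv≡ : ∀ (w : Perm∞) {i j} → fun w i ≡ j → inv w j ≡ i
fun≡⇒inv≡ w {i} refl = inv∘fun w i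

fun-injective : ∀ (w : Perm∞) {i k} → fun w i ≡ fun w k → i ≡ k
fun-injective w {i} {k} eq = trans (sym (fun≡⇒inv≡ w eq)) (inv∘fun w k)

id∞ : Perm∞
id∞ = record
  { fun = λ n → n ; inv = λ n → n
  ; inv∘fun = λ _ → refl ; fun∘inv = λ _ → refl
  ; finSupp = 0 , λ _ _ → refl }

prepend-fun : ℕ → (ℕ → ℕ) → ℕ → ℕ
prepend-fun c f zero    = c
prepend-fun c f (suc i) = punchInℕ c (f i)

prepend-inv : ℕ → (ℕ → ℕ) → ℕ → ℕ
prepend-inv c g j with j ≟ c
... | yes _ = zero
... | no  _ = suc (g (punchOutℕ c j))

prepend : ℕ → Perm∞ → Perm∞
prepend c w = record
  { fun = prepend-fun c (fun w) ; inv = prepend-inv c (inv w)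
  ; inv∘fun = inv∘fun′ ; fun∘inv = fun∘inv′ ; finSupp = finSupp′ (finSupp w) }
  where
  inv∘fun′ : ∀ n → prepend-inv c (inv w) (prepend-fun c (fun w) n) ≡ n
  inv∘fun′ zero with c ≟ c
  ... | yes _   = refl
  ... | no  c≢c = contradiction refl c≢c
  inv∘fun′ (suc i) with punchInℕ c (fun w i) ≟ c
  ... | yes eq = contradiction eq (punchInℕᵢ≢i c (fun w i))
  ... | no  _  = cong suc (trans (cong (inv w) (punchOutℕ-punchInℕ c (fun w i))) (inv∘fun w i))

  fun∘inv′ : ∀ n → prepend-fun c (fun w) (prepend-inv c (inv w) n) ≡ n
  fun∘inv′ j with j ≟ c
  ... | yes j≡c = sym j≡c
  ... | no  j≢c = trans (cong (punchInℕ c) (fun∘inv w (punchOutℕ c j))) (punchInℕ-punchOutℕ j≢c)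

  finSupp′ : Σ[ N ∈ ℕ ] (∀ n → N ≤ n → fun w n ≡ n) →
             Σ[ N ∈ ℕ ] (∀ n → N ≤ n → prepend-fun c (fun w) n ≡ n)
  finSupp′ (N , fixed) = suc (N ⊔ c) , λ where
    (suc n) (s≤s N⊔c≤n) → trans (cong (punchInℕ c) (fixed n (≤-trans (m≤m⊔n N c) N⊔c≤n)))
                                (punchInℕ-≥ (≤-trans (m≤n⊔m N c) N⊔c≤n))

prepend-inv-punchInℕ : ∀ c w j → inv (prepend c w) (punchInℕ c j) ≡ suc (inv w j)
prepend-inv-punchInℕ c w j = fun≡⇒inv≡ (prepend c w) (cong (punchInℕ c) (fun∘inv w j))

prepend-rothe : ∀ c w i j → InRothe (prepend c w) (suc i) (punchInℕ c j) ⇔ InRothe w i j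
prepend-rothe c w i j = mk⇔
  (λ (w>j , w⁻¹>i) → punchInℕ-cancel-< c w>j , ≤-pred (subst (suc i <_) (prepend-inv-punchInℕ c w j) w⁻¹>i))
  (λ (w>j , w⁻¹>i) → punchInℕ-mono-< c w>j , subst (suc i <_) (sym (prepend-inv-punchInℕ c w j)) (s≤s w⁻¹>i))

data PunchInℕView (c : ℕ) : ℕ → Set where
  at     : PunchInℕView c c
  beside : ∀ j → PunchInℕView c (punchInℕ c j)

punchInℕView : ∀ c j → PunchInℕView c j
punchInℕView c j with j ≟ c
... | yes refl = at
... | no  j≢c  = subst (PunchInℕView c) (punchInℕ-punchOutℕ j≢c) (beside (punchOutℕ c j))

record Peeling (s c : ℕ) (S S′ : ℕ → ℕ → Set) : Set where
  field
    row₀⊆        : ∀ {j} → S 0 j → j < c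
    row₀⊇        : ∀ {j} → s ≤ j → j < c → S 0 j
    column-empty : ∀ {i} → ¬ S (suc i) c
    rest⊆        : ∀ {i j} → S (suc i) (punchInℕ c j) → S′ i j
    rest⊇        : ∀ {i j} → S′ i j → S (suc i) (punchInℕ c j)

module _ {c S S′} (w : Perm∞) (P : Peeling 0 c S S′) (D : HasDiagram w S′) where
  open Peeling P
  open Equivalence

  prepend-hasDiagram : HasDiagram (prepend c w) S
  prepend-hasDiagram zero j = (λ (c>j , _) → row₀⊇ z≤n c>j) , λ s → row₀⊆ s , inv>0 (row₀⊆ s)
    where
    inv>0 : j < c → inv (prepend c w) j > 0
    inv>0 j<c = n≢0⇒n>0 λ inv≡0 →
      <-irrefl (trans (sym (fun∘inv (prepend c w) j)) (cong (prepend-fun c (fun w)) inv≡0)) j<c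
  prepend-hasDiagram (suc i) j with punchInℕView c j
  ... | at        = (λ (_ , inv>i) → ⊥-elim (n≮0 (subst (suc i <_) (fun≡⇒inv≡ (prepend c w) refl) inv>i)))
                  , ⊥-elim ∘ column-empty
  ... | beside j′ = rest⊇ ∘ proj₁ (D i j′) ∘ to (prepend-rothe c w i j′)
                  , from (prepend-rothe c w i j′) ∘ proj₂ (D i j′) ∘ rest⊆

module _ (S : ℕ → ℕ → Set) (w w′ : Perm∞) (D : HasDiagram w S) (D′ : HasDiagram w′ S) where

  -- The cell (i, w i) is never in D(w); if w i < w′ i it is in D(w′), because w′ agreeing with w
  -- before i and w′ i ≠ w i force w′⁻¹ (w i) > i.
  agree-before⇒fun≮fun : ∀ {i} → (∀ {k} → k < i → fun w k ≡ fun w′ k) → fun w i ≮ fun w′ i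
  agree-before⇒fun≮fun {i} agree w<w′ = <-irrefl refl (proj₁ (proj₂ (D i j) (proj₁ (D′ i j) (w<w′ , inv′>i))))
    where
    j = fun w i
    inv′>i : inv w′ j > i
    inv′>i with <-cmp (inv w′ j) i
    ... | tri< k<i _ _ = contradiction (fun-injective w (trans (agree k<i) (fun∘inv w′ j))) (<⇒≢ k<i)
    ... | tri≈ _ k≡i _ = contradiction (trans (cong (fun w′) (sym k≡i)) (fun∘inv w′ j)) (>⇒≢ w<w′)
    ... | tri> _ _ k>i = k>i

hasDiagram-unique : ∀ S w w′ → HasDiagram w S → HasDiagram w′ S → ∀ n → fun w n ≡ fun w′ n
hasDiagram-unique S w w′ D D′ = <-rec _ step
  where
  step : ∀ i → (∀ {k} → k < i → fun w k ≡ fun w′ k) → fun w i ≡ fun w′ i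
  step i agree with <-cmp (fun w i) (fun w′ i)
  ... | tri< w<w′ _ _ = contradiction w<w′ (agree-before⇒fun≮fun S w w′ D D′ agree)
  ... | tri≈ _ eq _   = eq
  ... | tri> _ _ w>w′ = contradiction w>w′ (agree-before⇒fun≮fun S w′ w D′ D (sym ∘ agree))

removeRow₀ : ∀ {m n} → Matrix01 (suc m) n → Matrix01 m n
removeRow₀ M i = M (fsuc i)

removeColumn : ∀ {m n} → Fin (suc n) → Matrix01 m (suc n) → Matrix01 m n
removeColumn c M i j = M i (punchIn c j)

isPartialPerm-removeRow₀ : ∀ {m n} {M : Matrix01 (suc m) n} → IsPartialPerm M → IsPartialPerm (removeRow₀ M)
isPartialPerm-removeRow₀ (rows , columns) =
  (λ i → rows (fsuc i)) , λ i i′ j x y → Fin.suc-injective (columns (fsuc i) (fsuc i′) j x y)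

isPartialPerm-removeColumn : ∀ {m n} {M : Matrix01 m (suc n)} c →
  IsPartialPerm M → IsPartialPerm (removeColumn c M)
isPartialPerm-removeColumn c (rows , columns) =
  (λ i j j′ x y → punchIn-injective c j j′ (rows i _ _ x y)) , λ i i′ j → columns i i′ (punchIn c j)

diagram-removeRow₀⁺ : ∀ {m n} (M : Matrix01 (suc m) n) {i j} →
  InDiagPP M (fsuc i) j → InDiagPP (removeRow₀ M) i j
diagram-removeRow₀⁺ M (row , column) = row , λ i′ i′≤i → column (fsuc i′) (s≤s i′≤i)

diagram-removeRow₀⁻ : ∀ {m n} (M : Matrix01 (suc m) n) {i j} →
  M fzero j ≡ false → InDiagPP (removeRow₀ M) i j → InDiagPP M (fsuc i) j
diagram-removeRow₀⁻ M M₀j≡false (row , column) = row , λ where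
  fzero     _           → M₀j≡false
  (fsuc i′) (s≤s i′≤i) → column i′ i′≤i

diagram-removeColumn⁺ : ∀ {m n} (M : Matrix01 m (suc n)) c {i j} →
  InDiagPP M i (punchIn c j) → InDiagPP (removeColumn c M) i j
diagram-removeColumn⁺ M c (row , column) = (λ j′ j′≤j → row (punchIn c j′) (punchIn-mono-≤ c _ _ j′≤j)) , column

data PunchInView {n} (c : Fin (suc n)) : Fin (suc n) → Set where
  at     : PunchInView c c
  beside : ∀ j → PunchInView c (punchIn c j)

punchInView : ∀ {n} (c k : Fin (suc n)) → PunchInView c k
punchInView c k with c Fin.≟ k
... | yes refl = at
... | no  c≢k  = subst (PunchInView c) (punchIn-punchOut c≢k) (beside (punchOut c≢k))

diagram-removeColumn⁻ : ∀ {m n} (M : Matrix01 m (suc n)) c {i j} →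
  (∀ i → M i c ≡ false) → InDiagPP (removeColumn c M) i j → InDiagPP M i (punchIn c j)
diagram-removeColumn⁻ M c {i} {j} column-c-empty (row , column) = row′ , column
  where
  row′ : ∀ k → toℕ k ≤ toℕ (punchIn c j) → M i k ≡ false
  row′ k k≤ with punchInView c k
  ... | at        = column-c-empty i
  ... | beside k′ = row k′ (punchIn-cancel-≤ c _ _ k≤)

ShiftedDiagram : ∀ {m n} → ℕ → Matrix01 m n → ℕ → ℕ → Set
ShiftedDiagram {m} {n} s M i j =
  Σ[ i′ ∈ Fin m ] Σ[ j′ ∈ Fin n ] (i ≡ toℕ i′) × (j ≡ s + toℕ j′) × InDiagPP M i′ j′

shiftedDiagram-< : ∀ {m n} s (M : Matrix01 m n) {i j} → ShiftedDiagram s M i j → j < s + n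
shiftedDiagram-< s M (_ , j′ , _ , refl , _) = +-monoʳ-< s (toℕ<n j′)

shifted-column : ∀ {n} s {c j} → c ≤ n → s ≤ j → j < s + c →
  Σ[ j′ ∈ Fin n ] (j ≡ s + toℕ j′) × (toℕ j′ < c)
shifted-column s {c} c≤n s≤j j<s+c with m≤n⇒∃[o]m+o≡n s≤j
... | d , refl = fromℕ< (<-≤-trans d<c c≤n)
               , cong (s +_) (sym (toℕ-fromℕ< _)) , subst (_< c) (sym (toℕ-fromℕ< _)) d<c
  where d<c = +-cancelˡ-< s d c j<s+c

record RowPeeling {m n} (s : ℕ) (M : Matrix01 (suc m) n) : Set where
  field
    {n′}             : ℕ
    M′               : Matrix01 m n′
    M′-isPartialPerm : IsPartialPerm M′
    c                : ℕ
    s≤c              : s ≤ c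
    peeling          : Peeling s c (ShiftedDiagram s M) (ShiftedDiagram s M′)

module _ {m n} {M : Matrix01 (suc m) n} (row₀-empty : ∀ j → M fzero j ≡ false) (s : ℕ) where

  private
    row₀-diagram : ∀ {j} → InDiagPP M fzero j
    row₀-diagram {j} = (λ j′ _ → row₀-empty j′) , λ where fzero _ → row₀-empty j

    row₀⊇ : ∀ {j} → s ≤ j → j < s + n → ShiftedDiagram s M 0 j
    row₀⊇ s≤j j<c = let j′ , j≡ , _ = shifted-column s ≤-refl s≤j j<c in fzero , j′ , refl , j≡ , row₀-diagram

    rest⊆ : ∀ {i j} → ShiftedDiagram s M (suc i) (punchInℕ (s + n) j) → ShiftedDiagram s (removeRow₀ M) i j
    rest⊆ d@(fsuc i′ , j′ , i≡ , j≡ , d′) =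
      i′ , j′ , suc-injective i≡ , trans (sym (punchInℕ<c⇒≡ (shiftedDiagram-< s M d))) j≡ , diagram-removeRow₀⁺ M d′

    rest⊇ : ∀ {i j} → ShiftedDiagram s (removeRow₀ M) i j → ShiftedDiagram s M (suc i) (punchInℕ (s + n) j)
    rest⊇ d@(i′ , j′ , i≡ , j≡ , d′) =
      fsuc i′ , j′ , cong suc i≡ , trans (punchInℕ-< (shiftedDiagram-< s (removeRow₀ M) d)) j≡
      , diagram-removeRow₀⁻ M (row₀-empty j′) d′

  emptyRow-peeling : Peeling s (s + n) (ShiftedDiagram s M) (ShiftedDiagram s (removeRow₀ M))
  emptyRow-peeling = record
    { row₀⊆ = shiftedDiagram-< s M ; row₀⊇ = row₀⊇ ; column-empty = <-irrefl refl ∘ shiftedDiagram-< s M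
    ; rest⊆ = rest⊆ ; rest⊇ = rest⊇ }

module _ {m n} {M : Matrix01 (suc m) (suc n)} (pp : IsPartialPerm M) {c₀ : Fin (suc n)} (hit : M fzero c₀ ≡ true)
         (s : ℕ) where

  private
    M′ : Matrix01 m n
    M′ = removeColumn c₀ (removeRow₀ M)

    row₀-false : ∀ {j} → j ≢ c₀ → M fzero j ≡ false
    row₀-false j≢c₀ = ¬-not λ M₀j → j≢c₀ (proj₁ pp fzero _ _ M₀j hit)

    column-false : ∀ i → removeRow₀ M i c₀ ≡ false
    column-false i = ¬-not λ Mᵢc₀ → Fin.0≢1+n (sym (proj₂ pp _ _ c₀ Mᵢc₀ hit))

    row₀-diagram⁺ : ∀ {j} → InDiagPP M fzero j → toℕ j < toℕ c₀
    row₀-diagram⁺ (row , _) = ≰⇒> λ c₀≤j → contradiction (trans (sym hit) (row c₀ c₀≤j)) λ ()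

    row₀-diagram⁻ : ∀ {j} → toℕ j < toℕ c₀ → InDiagPP M fzero j
    row₀-diagram⁻ j<c₀ = (λ j′ j′≤j → row₀-false (Fin.<⇒≢ (≤-<-trans j′≤j j<c₀)))
                       , λ where fzero _ → row₀-false (Fin.<⇒≢ j<c₀)

    column-c₀-outside : ∀ {i} → ¬ InDiagPP M (fsuc i) c₀
    column-c₀-outside (_ , column) = contradiction (trans (sym hit) (column fzero z≤n)) λ ()

    rest-diagram⁺ : ∀ {i j} → InDiagPP M (fsuc i) (punchIn c₀ j) → InDiagPP M′ i j
    rest-diagram⁺ = diagram-removeColumn⁺ (removeRow₀ M) c₀ ∘ diagram-removeRow₀⁺ M

    rest-diagram⁻ : ∀ {i j} → InDiagPP M′ i j → InDiagPP M (fsuc i) (punchIn c₀ j)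
    rest-diagram⁻ {j = j} = diagram-removeRow₀⁻ M (row₀-false (Fin.punchInᵢ≢i c₀ j))
                          ∘ diagram-removeColumn⁻ (removeRow₀ M) c₀ column-false

    c : ℕ
    c = s + toℕ c₀

    shift-punchIn : ∀ k → s + toℕ (punchIn c₀ k) ≡ punchInℕ c (s + toℕ k)
    shift-punchIn k = trans (cong (s +_) (toℕ-punchIn c₀ k)) (sym (punchInℕ-+ s (toℕ c₀) (toℕ k)))

    row₀⊆ : ∀ {j} → ShiftedDiagram s M 0 j → j < c
    row₀⊆ (fzero , _ , _ , refl , d) = +-monoʳ-< s (row₀-diagram⁺ d)

    row₀⊇ : ∀ {j} → s ≤ j → j < c → ShiftedDiagram s M 0 j
    row₀⊇ s≤j j<c = let j′ , j≡ , j′<c₀ = shifted-column s (Fin.toℕ≤n c₀) s≤j j<c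
                    in fzero , j′ , refl , j≡ , row₀-diagram⁻ j′<c₀

    column-empty : ∀ {i} → ¬ ShiftedDiagram s M (suc i) c
    column-empty (fsuc i′ , j′ , _ , c≡ , d) with punchInView c₀ j′
    ... | at       = column-c₀-outside d
    ... | beside k = punchInℕᵢ≢i c (s + toℕ k) (sym (trans c≡ (shift-punchIn k)))

    rest⊆ : ∀ {i j} → ShiftedDiagram s M (suc i) (punchInℕ c j) → ShiftedDiagram s M′ i j
    rest⊆ {j = j} (fsuc i′ , j′ , i≡ , j≡ , d) with punchInView c₀ j′
    ... | at       = contradiction j≡ (punchInℕᵢ≢i c j)
    ... | beside k =
      i′ , k , suc-injective i≡ , punchInℕ-injective c (trans j≡ (shift-punchIn k)) , rest-diagram⁺ d

    rest⊇ : ∀ {i j} → ShiftedDiagram s M′ i j → ShiftedDiagram s M (suc i) (punchInℕ c j)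
    rest⊇ (i′ , k , i≡ , refl , d) = fsuc i′ , punchIn c₀ k , cong suc i≡ , sym (shift-punchIn k) , rest-diagram⁻ d

  hitRow-peeling : Peeling s (s + toℕ c₀) (ShiftedDiagram s M)
                           (ShiftedDiagram s (removeColumn c₀ (removeRow₀ M)))
  hitRow-peeling = record
    { row₀⊆ = row₀⊆ ; row₀⊇ = row₀⊇ ; column-empty = column-empty ; rest⊆ = rest⊆ ; rest⊇ = rest⊇ }

rowPeeling-emptyRow : ∀ {m n} {M : Matrix01 (suc m) n} →
  IsPartialPerm M → (∀ j → M fzero j ≡ false) → ∀ s → RowPeeling s M
rowPeeling-emptyRow {n = n} {M} pp row₀-empty s = record
  { M′ = removeRow₀ M ; M′-isPartialPerm = isPartialPerm-removeRow₀ pp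
  ; c = s + n ; s≤c = m≤m+n s n ; peeling = emptyRow-peeling row₀-empty s }

rowPeeling : ∀ {m n} {M : Matrix01 (suc m) n} → IsPartialPerm M → ∀ s → RowPeeling s M
rowPeeling {n = zero} pp s = rowPeeling-emptyRow pp (λ ()) s
rowPeeling {n = suc n} {M} pp s with Fin.any? (λ j → M fzero j Bool.≟ true)
... | yes (c₀ , hit) = record
  { M′ = removeColumn c₀ (removeRow₀ M)
  ; M′-isPartialPerm = isPartialPerm-removeColumn c₀ (isPartialPerm-removeRow₀ pp)
  ; c = s + toℕ c₀ ; s≤c = m≤m+n s (toℕ c₀) ; peeling = hitRow-peeling pp hit s }
... | no  no-hit = rowPeeling-emptyRow pp (λ j → ¬-not λ hit → no-hit (j , hit)) s

diagram-realisable : ∀ {p b} (u : Matrix01 p b) → IsPartialPerm u →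
  Σ[ w ∈ Perm∞ ] HasDiagram w (ShiftedDiagram 0 u)
diagram-realisable {zero} u _ = id∞ , λ i j → (λ (i>j , j>i) → contradiction i>j (<-asym j>i)) , λ ()
diagram-realisable {suc p} u pu =
  let open RowPeeling (rowPeeling pu 0)
      w , D = diagram-realisable M′ M′-isPartialPerm
  in prepend c w , prepend-hasDiagram w peeling D

module _ {p b a q} {u : Matrix01 p b} {v : Matrix01 (suc a) q} (P : RowPeeling b v) where
  open RowPeeling P
  private
    module P = Peeling peeling

    u-column<c : (j : Fin b) → toℕ j < c
    u-column<c j = <-≤-trans (toℕ<n j) s≤c

    row₀⊆ : ∀ {j} → InTarget u v 0 j → j < c
    row₀⊆ (inj₁ (_ , j<b))                = <-≤-trans j<b s≤c
    row₀⊆ (inj₂ (inj₁ d))                 = P.row₀⊆ d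
    row₀⊆ (inj₂ (inj₂ (_ , _ , () , _)))

    row₀⊇ : ∀ {j} → 0 ≤ j → j < c → InTarget u v 0 j
    row₀⊇ {j} _ j<c with j <? b
    ... | yes j<b = inj₁ (s≤s z≤n , j<b)
    ... | no  j≮b = inj₂ (inj₁ (P.row₀⊇ (≮⇒≥ j≮b) j<c))

    column-empty : ∀ {i} → ¬ InTarget u v (suc i) c
    column-empty (inj₁ (_ , c<b))                      = <-irrefl refl (<-≤-trans c<b s≤c)
    column-empty (inj₂ (inj₁ d))                       = P.column-empty d
    column-empty (inj₂ (inj₂ (_ , j′ , _ , refl , _))) = <-irrefl refl (u-column<c j′)

    rest⊆ : ∀ {i j} → InTarget u v (suc i) (punchInℕ c j) → InTarget u M′ i j
    rest⊆ {j = j} (inj₁ (i<a , p<b)) = inj₁ (≤-pred i<a , ≤-<-trans (j≤punchInℕ c j) p<b)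
    rest⊆ (inj₂ (inj₁ d)) = inj₂ (inj₁ (P.rest⊆ d))
    rest⊆ (inj₂ (inj₂ (i′ , j′ , i≡ , j≡ , d))) = inj₂ (inj₂ (i′ , j′ , suc-injective i≡ , j≡′ , d))
      where j≡′ = trans (sym (punchInℕ<c⇒≡ (subst (_< c) (sym j≡) (u-column<c j′)))) j≡

    rest⊇ : ∀ {i j} → InTarget u M′ i j → InTarget u v (suc i) (punchInℕ c j)
    rest⊇ (inj₁ (i<a , j<b)) = inj₁ (s≤s i<a , subst (_< b) (sym (punchInℕ-< (<-≤-trans j<b s≤c))) j<b)
    rest⊇ (inj₂ (inj₁ d)) = inj₂ (inj₁ (P.rest⊇ d))
    rest⊇ (inj₂ (inj₂ (i′ , j′ , i≡ , refl , d))) =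
      inj₂ (inj₂ (i′ , j′ , cong suc i≡ , punchInℕ-< (u-column<c j′) , d))

  target-peeling : Peeling 0 c (InTarget u v) (InTarget u M′)
  target-peeling = record
    { row₀⊆ = row₀⊆ ; row₀⊇ = row₀⊇ ; column-empty = column-empty ; rest⊆ = rest⊆ ; rest⊇ = rest⊇ }

target-realisable : ∀ {p b a q} (u : Matrix01 p b) (v : Matrix01 a q) →
  IsPartialPerm u → IsPartialPerm v → Σ[ w ∈ Perm∞ ] HasDiagram w (InTarget u v)
target-realisable {a = zero} u v pu _ =
  let w , D = diagram-realisable u pu
  in w , λ i j → inj₂ ∘ inj₂ ∘ proj₁ (D i j) , λ where
       (inj₁ (() , _))
       (inj₂ (inj₁ (() , _)))
       (inj₂ (inj₂ d)) → proj₂ (D i j) d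
target-realisable {b = b} {a = suc a} u v pu pv =
  let P = rowPeeling pv b
      open RowPeeling P
      w , D = target-realisable u M′ pu M′-isPartialPerm
  in prepend c w , prepend-hasDiagram w (target-peeling P) D

lemma4p1 : ∀ {p b a q} (u : Matrix01 p b) (v : Matrix01 a q) →
    IsPartialPerm u → IsPartialPerm v →
    Σ[ w ∈ Perm∞ ] (HasDiagram w (InTarget u v) ×
      (∀ (w′ : Perm∞) → HasDiagram w′ (InTarget u v) → ∀ n → fun w′ n ≡ fun w n))
lemma4p1 u v pu pv =
  let w , D = target-realisable u v pu pv
  in w , D , λ w′ D′ → hasDiagram-unique (InTarget u v) w′ w D′ D
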